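{- Let $\lambda$ be a strict partition and let $\mathsf{SetDecTab}^\ast(\lambda)$ be the set of multiset-valued decomposition tableaux of shape $\lambda$ in which only the number $1$ may occur more than once in a given box. Then the operations $e^\ast_{\overline 1}$ and $f^\ast_{\overline 1}$ (defined below) define maps $\mathsf{SetDecTab}^\ast(\lambda)\to\mathsf{SetDecTab}^\ast(\lambda)\sqcup\{0\}$, and for all $T,U\in\mathsf{SetDecTab}^\ast(\lambda)$ we have $e^\ast_{\overline 1}(T)=U$ if and only if $T=f^\ast_{\overline 1}(U)$.
   Context: A strict partition is $\lambda=(\lambda_1>\lambda_2>\dots>\lambda_\ell>0)$. Its shifted diagram is $\mathsf{SD}_\lambda=\{(r,r+j-1): r\in[\ell],\ j\in[\lambda_r]\}$; box $(r,c)$ lies in row $r$ and column $c$. A hook word is a finite sequence $w_1\cdots w_k$ of positive integers with $w_1\ge w_2\ge\dots\ge w_m<w_{m+1}<\dots<w_k$ for some $m\in[k]$. A (semistandard) decomposition tableau of shape $\lambda$ is a map $T:\mathsf{SD}_\lambda\to\mathbb{Z}_{>0}$ such that, writing $\rho_r$ for the entries of row $r$ read in increasing column order, each $\rho_r$ is a hook word and, for each $r\in[\ell-1]$, $\rho_r$ is a hook subword (subsequence which is a hook word) of maximal length in the concatenation $\rho_{r+1}\rho_r$. A multiset-valued decomposition tableau of shape $\lambda$ assigns to each box of $\mathsf{SD}_\lambda$ a finite nonempty multiset of positive integers such that every distribution (a tableau obtained by choosing one element from each box) is a decomposition tableau. The reverse row reading order on boxes reads row $1$ from right to left, then row $2$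 from right to left, and so on; $\mathsf{revrow}(T)$ is the word obtained by listing the boxes in this order and writing the elements of each box in weakly decreasing order. Operators: $e^\ast_{\overline 1}(T)=0$ if $2$ does not occur in $\mathsf{revrow}(T)$ or the first $2$ in $\mathsf{revrow}(T)$ comes after a $1$; otherwise $e^\ast_{\overline 1}(T)$ is obtained by changing the (box entry corresponding to the) first $2$ of $\mathsf{revrow}(T)$ into a $1$. Similarly $f^\ast_{\overline 1}(T)=0$ if $1$ does not occur in $\mathsf{revrow}(T)$ or the first $1$ comes after a $2$; otherwise $f^\ast_{\overline 1}(T)$ is obtained by changing the first $1$ of $\mathsf{revrow}(T)$ into a $2$. Here $0$ is a formal symbol not in $\mathsf{SetDecTab}^\ast(\lambda)$. -}

module Defs where

open import Data.Nat using (ℕ; zero; suc; _≤_; _<_; _≥_; _>_; _∸_; _≡ᵇ_)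
open import Data.List using (List; []; _∷_; _++_; length; take; drop; reverse; concat; concatMap; map)
open import Data.List.Relation.Unary.All using (All)
open import Data.List.Relation.Unary.Linked using (Linked)
open import Data.List.Relation.Binary.Pointwise using (Pointwise)
open import Data.List.Relation.Binary.Sublist.Propositional using (_⊆_)
open import Data.List.Membership.Propositional using (_∈_)
open import Data.Maybe using (Maybe; just; nothing)
open import Data.Bool using (Bool; true; false; if_then_else_)
open import Data.Product using (Σ; _×_; ∃-syntax)
open import Relation.Binary.PropositionalEquality using (_≡_; _≢_)
open import Relation.Nullary using (¬_)

StrictPartition : List ℕ → Set
StrictPartition μ = Linked _>_ μ × All (λ p → p > 0) μ

-- Hook words: w₁ ≥ … ≥ w_m < w_{m+1} < … < w_k for some m ∈ [k]
-- (w₁…w_m = take m w,  w_m…w_k = drop (m ∸ 1) w)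

IsHookWord : List ℕ → Set
IsHookWord w = ∃[ m ] (1 ≤ m × m ≤ length w
                       × Linked _≥_ (take m w)
                       × Linked _<_ (drop (m ∸ 1) w))

MaxHookSubword : List ℕ → List ℕ → Set
MaxHookSubword σ ρ =
  IsHookWord ρ × ρ ⊆ (σ ++ ρ) ×
  ((v : List ℕ) → v ⊆ (σ ++ ρ) → IsHookWord v → length v ≤ length ρ)

-- Tableaux are given by their rows ρ₁, ρ₂, … (row r listed in increasing
-- column order); the shifted placement of the rows does not enter the
-- definition of decomposition tableaux, which only refers to rows.

HasShape : {A : Set} → List ℕ → List (List A) → Set
HasShape μ T = Pointwise (λ row n → length row ≡ n) T μ

RowsCondition : List (List ℕ) → Set
RowsCondition [] = Data.Unit.⊤ where import Data.Unit
RowsCondition (ρ ∷ []) = Data.Unit.⊤ where import Data.Unit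
RowsCondition (ρ ∷ σ ∷ rest) = MaxHookSubword σ ρ × RowsCondition (σ ∷ rest)

IsDecTab : List ℕ → List (List ℕ) → Set
IsDecTab μ T = HasShape μ T × All (All (λ x → x > 0)) T
             × All IsHookWord T × RowsCondition T

-- Multiset-valued tableaux. A box is a finite multiset of positive
-- integers, represented canonically as a list sorted weakly decreasingly.

Box : Set
Box = List ℕ

MTab : Set
MTab = List (List Box)

ValidBox : Box → Set
ValidBox b = b ≢ [] × Linked _≥_ b × All (λ x → x > 0) b

multiplicity : ℕ → List ℕ → ℕ
multiplicity x [] = 0
multiplicity x (y ∷ ys) = if x ≡ᵇ y then suc (multiplicity x ys) else multiplicity x ys

OnlyOneRepeats : Box → Set
OnlyOneRepeats b = ∀ x → x ≢ 1 → multiplicity x b ≤ 1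

IsDistribution : List (List ℕ) → MTab → Set
IsDistribution D T = Pointwise (Pointwise _∈_) D T

SetDecTab* : List ℕ → MTab → Set
SetDecTab* μ T = HasShape μ T
               × All (All ValidBox) T
               × All (All OnlyOneRepeats) T
               × ((D : List (List ℕ)) → IsDistribution D T → IsDecTab μ D)

-- reverse row reading word: row 1 right to left, then row 2, …;
-- each box's elements in weakly decreasing order (the stored order).

revrow : MTab → List ℕ
revrow T = concatMap (λ row → concat (reverse row)) T

firstOf12 : List ℕ → Maybe ℕ
firstOf12 [] = nothing
firstOf12 (1 ∷ w) = just 1
firstOf12 (2 ∷ w) = just 2
firstOf12 (x ∷ w) = firstOf12 w

replFirst : {A : Set} → (A → Maybe A) → List A → Maybe (List A)
replFirst g [] = nothing
replFirst g (x ∷ xs) with g x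
... | just y = just (y ∷ xs)
... | nothing with replFirst g xs
...   | just ys = just (x ∷ ys)
...   | nothing = nothing

replLetter : ℕ → ℕ → ℕ → Maybe ℕ
replLetter a b x = if x ≡ᵇ a then just b else nothing

mapMaybe' : {A B : Set} → (A → B) → Maybe A → Maybe B
mapMaybe' h nothing = nothing
mapMaybe' h (just x) = just (h x)

-- change the box entry corresponding to the first a in revrow T into b
-- (nothing if a does not occur in revrow T)
replTab : ℕ → ℕ → MTab → Maybe MTab
replTab a b = replFirst replRow
  where
  replRow : List Box → Maybe (List Box)
  replRow row = mapMaybe' reverse (replFirst (replFirst (replLetter a b)) (reverse row))

-- e*_{1̄}:  nothing encodes the formal symbol 0.
-- "2 occurs in revrow T and the first 2 does not come after a 1" is
-- exactly "the first letter of revrow T lying in {1,2} is 2".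
e*₁ : MTab → Maybe MTab
e*₁ T with firstOf12 (revrow T)
... | just 2 = replTab 2 1 T
... | _ = nothing

f*₁ : MTab → Maybe MTab
f*₁ T with firstOf12 (revrow T)
... | just 1 = replTab 1 2 T
... | _ = nothing

{-# OPTIONS --safe #-}
-- Read along revrow T, every letter before the first 1 or 2 is at least 3. Hence e*₁ and f*₁ both
-- exchange a letter x ∈ {1,2} of one box for the other small letter, at a position such that the
-- rows above it, the boxes to its right and the larger entries of its own box contain only letters
-- ≥ 3; conversely such an exchange is e*₁ or f*₁. In every distribution the letters after x in its
-- row are ≥ 3, so x is the bottom of its hook or immediately follows it, and the same holds after
-- the exchange: rows stay hook words, and hook subwords of ρ_{r+1} ρ_r through the position
-- correspond to each other, so maximal lengths are unchanged. Boxes stay valid because 2 occurs at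
-- most once in a box. Since e*₁ T = U and f*₁ U = T describe the same exchange, they are equivalent.
module Submission where

open import Defs
open import Data.Nat using (ℕ; zero; suc; _≤_; _<_; _≥_; _≡ᵇ_; z≤n; s≤s; _≤?_; _≟_)
open import Data.Nat.Properties
  using (≤-refl; ≤-trans; <-trans; ≤-reflexive; ≤-pred; <⇒≱; ≰⇒>; ≤∧≢⇒<; n≤1+n; n≤0⇒n≡0; ≡ᵇ⇒≡; ≡⇒≡ᵇ)
import Data.Bool as Bool
open import Data.Bool using (true; false)
open import Data.Empty using (⊥-elim)
open import Data.List using (List; []; _∷_; _++_; length; reverse; concat; take; drop)
open import Data.List.Properties
  using (++-assoc; length-++; reverse-++; unfold-reverse; reverse-involutive; concat-++; concatMap-++; ++-monoid)
open import Data.List.Relation.Unary.All as All using (All; []; _∷_)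
open import Data.List.Relation.Unary.All.Properties using (++⁺; ++⁻ˡ; ++⁻ʳ; concat⁺; concat⁻)
open import Data.List.Relation.Unary.Linked as Linked using (Linked; []; [-]; _∷_)
open import Data.List.Relation.Binary.Pointwise as Pointwise using (Pointwise; []; _∷_)
open import Data.List.Relation.Binary.Sublist.Propositional using (_⊆_; []; _∷_; _∷ʳ_; ⊆-refl; ⊆-trans)
open import Data.List.Relation.Binary.Sublist.Propositional.Properties as Sublist using (All-resp-⊆)
open import Data.List.Relation.Binary.Permutation.Propositional using (↭-sym)
open import Data.List.Relation.Binary.Permutation.Propositional.Properties using (All-resp-↭; ↭-reverse)
open import Data.List.Membership.Propositional using (_∈_)
open import Data.List.Membership.Propositional.Properties using (∈-insert; ∈-++⁻; ∈-++⁺ˡ; ∈-++⁺ʳ)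
open import Data.List.Relation.Unary.Any using (here; there)
open import Data.Maybe using (Maybe; just; nothing)
open import Data.Maybe.Properties using (just-injective)
open import Data.Product using (_×_; _,_; proj₁; proj₂; ∃-syntax)
open import Data.Sum using (_⊎_; inj₁; inj₂)
open import Data.Unit using (tt)
open import Function using (_∘_)
open import Function.Bundles using (_⇔_; mk⇔; Equivalence)
open import Function.Construct.Composition using (_⇔-∘_)
open import Function.Construct.Symmetry using (⇔-sym)
open import Relation.Nullary using (¬_; Dec; yes; no)
open import Relation.Binary.PropositionalEquality
  using (_≡_; _≢_; refl; sym; trans; cong; cong₂; subst; subst₂; ≢-sym; module ≡-Reasoning)
open import Tactic.MonoidSolver using (solve)

private
  variable
    A : Set
    x y z u n : ℕ
    a b w post : List ℕ

data Small : ℕ → Set where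
  one : Small 1
  two : Small 2

NotSmall : ℕ → Set
NotSmall z = ¬ Small z

Large : ℕ → Set
Large z = 3 ≤ z

small? : (z : ℕ) → Dec (Small z)
small? 0 = no λ ()
small? 1 = yes one
small? 2 = yes two
small? (suc (suc (suc _))) = no λ ()

small≤2 : Small x → x ≤ 2
small≤2 one = s≤s z≤n
small≤2 two = ≤-refl

small-positive : Small x → 0 < x
small-positive one = s≤s z≤n
small-positive two = s≤s z≤n

small<large : Small x → Large z → x < z
small<large sx lz = ≤-trans (s≤s (small≤2 sx)) lz

notSmall⇒≢ : Small x → NotSmall z → z ≢ x
notSmall⇒≢ sx nz refl = nz sx

notSmall-positive⇒large : NotSmall z → 0 < z → Large z
notSmall-positive⇒large {1} nz _ = ⊥-elim (nz one)
notSmall-positive⇒large {2} nz _ = ⊥-elim (nz two)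
notSmall-positive⇒large {suc (suc (suc _))} _ _ = s≤s (s≤s (s≤s z≤n))

allLarge : All NotSmall w → All (0 <_) w → All Large w
allLarge ns ps = All.zipWith (λ (n , p) → notSmall-positive⇒large n p) (ns , ps)

data Hook : List ℕ → Set where
  increasing : Linked _<_ (z ∷ w) → Hook (z ∷ w)
  descent    : u ≤ z → Hook (u ∷ w) → Hook (z ∷ u ∷ w)

Hook⇒IsHookWord : Hook w → IsHookWord w
Hook⇒IsHookWord (increasing inc) = 1 , s≤s z≤n , s≤s z≤n , [-] , inc
Hook⇒IsHookWord (descent u≤z h) with Hook⇒IsHookWord h
... | zero , () , _
... | suc m , _ , m<len , dec , inc = suc (suc m) , s≤s z≤n , s≤s m<len , u≤z ∷ dec , inc

IsHookWord⇒Hook : IsHookWord w → Hook w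
IsHookWord⇒Hook (zero , () , _)
IsHookWord⇒Hook (suc m , _ , m<len , dec , inc) = fromValley m _ m<len dec inc
  where
  fromValley : ∀ m w → suc m ≤ length w → Linked _≥_ (take (suc m) w) → Linked _<_ (drop m w) → Hook w
  fromValley zero (z ∷ w) _ _ inc = increasing inc
  fromValley (suc m) (z ∷ u ∷ w) (s≤s m<len) (u≤z ∷ dec) inc =
    descent u≤z (fromValley m (u ∷ w) m<len dec inc)
  fromValley (suc m) (z ∷ []) (s≤s ()) _ _

Hook-tail : Hook (z ∷ u ∷ w) → Hook (u ∷ w)
Hook-tail (increasing inc) = increasing (Linked.tail inc)
Hook-tail (descent _ h) = h

Hook-suffix : ∀ a → Hook (a ++ z ∷ w) → Hook (z ∷ w)
Hook-suffix [] h = h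
Hook-suffix (_ ∷ []) h = Hook-tail h
Hook-suffix (_ ∷ v ∷ a) h = Hook-suffix (v ∷ a) (Hook-tail h)

Hook-small∷large⇒increasing : Small x → All Large b → Hook (x ∷ b) → Linked _<_ b
Hook-small∷large⇒increasing _ _ (increasing inc) = Linked.tail inc
Hook-small∷large⇒increasing sx (lu ∷ _) (descent u≤x _) = ⊥-elim (<⇒≱ (small<large sx lu) u≤x)

small∷increasing : Small y → All Large b → Linked _<_ b → Linked _<_ (y ∷ b)
small∷increasing _ [] [] = [-]
small∷increasing sy (lu ∷ _) inc = small<large sy lu ∷ inc

increasing⇒head< : ∀ a → Linked _<_ (u ∷ a ++ x ∷ b) → u < x
increasing⇒head< [] (u<x ∷ _) = u<x
increasing⇒head< (_ ∷ a) (u<v ∷ inc) = <-trans u<v (increasing⇒head< a inc)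

Hook-changeSmall : Small x → Small y → ∀ a → All (0 <_) a → All Large b →
  Hook (a ++ x ∷ b) → Hook (a ++ y ∷ b)
Hook-changeSmall {x} {y} {b} sx sy a pos lb h = go a pos h
  where
  y∷b↗ : Linked _<_ (y ∷ b)
  y∷b↗ = small∷increasing sy lb (Hook-small∷large⇒increasing sx lb (Hook-suffix a h))
  go : ∀ a → All (0 <_) a → Hook (a ++ x ∷ b) → Hook (a ++ y ∷ b)
  go [] _ _ = increasing y∷b↗
  go (u ∷ []) _ _ with y ≤? u
  ... | yes y≤u = descent y≤u (increasing y∷b↗)
  ... | no y≰u = increasing (≰⇒> y≰u ∷ y∷b↗)
  go (u ∷ v ∷ a) (0<u ∷ _) (increasing (u<v ∷ inc)) = ⊥-elim (<⇒≱ 2<x (small≤2 sx))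
    where
    2<x : 2 < x
    2<x = ≤-trans (s≤s (≤-trans (s≤s 0<u) u<v)) (increasing⇒head< a inc)
  go (u ∷ v ∷ a) (_ ∷ pos) (descent v≤u h) = descent v≤u (go (v ∷ a) pos h)

⊆-split : ∀ (pre : List A) {post y v} → v ⊆ pre ++ y ∷ post →
  v ⊆ pre ++ post ⊎ ∃[ a ] ∃[ b ] (v ≡ a ++ y ∷ b × a ⊆ pre × b ⊆ post)
⊆-split [] (_ ∷ʳ v⊆) = inj₁ v⊆
⊆-split [] (refl ∷ v⊆) = inj₂ ([] , _ , refl , [] , v⊆)
⊆-split (p ∷ pre) (.p ∷ʳ v⊆) with ⊆-split pre v⊆
... | inj₁ v⊆′ = inj₁ (p ∷ʳ v⊆′)
... | inj₂ (a , b , refl , a⊆ , b⊆) = inj₂ (a , b , refl , p ∷ʳ a⊆ , b⊆)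
⊆-split (p ∷ pre) (refl ∷ v⊆) with ⊆-split pre v⊆
... | inj₁ v⊆′ = inj₁ (refl ∷ v⊆′)
... | inj₂ (a , b , refl , a⊆ , b⊆) = inj₂ (p ∷ a , b , refl , refl ∷ a⊆ , b⊆)

length-replace : ∀ (a : List A) {x y b} → length (a ++ x ∷ b) ≡ length (a ++ y ∷ b)
length-replace a = trans (length-++ a) (sym (length-++ a))

HookSubwordsAtMost : ℕ → List ℕ → Set
HookSubwordsAtMost n w = (v : List ℕ) → v ⊆ w → IsHookWord v → length v ≤ n

-- A hook subword through the new letter y becomes, with x put back, a hook subword of the old word.
HookSubwordsAtMost-changeSmall : Small x → Small y → ∀ pre → All (0 <_) pre → All Large post →
  HookSubwordsAtMost n (pre ++ x ∷ post) → HookSubwordsAtMost n (pre ++ y ∷ post)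
HookSubwordsAtMost-changeSmall {x} {y} {post} {n} sx sy pre pos lpost bound v v⊆ hv with ⊆-split pre v⊆
... | inj₁ v⊆′ = bound v (⊆-trans v⊆′ (Sublist.++⁺ ⊆-refl (x ∷ʳ ⊆-refl))) hv
... | inj₂ (a , b , refl , a⊆ , b⊆) =
  subst (_≤ n) (length-replace a)
    (bound (a ++ x ∷ b) (Sublist.++⁺ a⊆ (refl ∷ b⊆))
      (Hook⇒IsHookWord (Hook-changeSmall sy sx a (All-resp-⊆ a⊆ pos) (All-resp-⊆ b⊆ lpost)
        (IsHookWord⇒Hook hv))))

MaxHookSubword-changeSmallˡ : ∀ {dl dr ρ} → Small x → Small y → All (0 <_) dl → All Large (dr ++ ρ) →
  MaxHookSubword (dl ++ x ∷ dr) ρ → MaxHookSubword (dl ++ y ∷ dr) ρ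
MaxHookSubword-changeSmallˡ {x} {y} {dl} {dr} {ρ} sx sy pdl ldrρ (hρ , _ , bound) =
  hρ , Sublist.++⁺ˡ (dl ++ y ∷ dr) ⊆-refl ,
  subst (HookSubwordsAtMost _) (sym (++-assoc dl (y ∷ dr) ρ))
    (HookSubwordsAtMost-changeSmall sx sy dl pdl ldrρ
      (subst (HookSubwordsAtMost _) (++-assoc dl (x ∷ dr) ρ) bound))

MaxHookSubword-changeSmallʳ : ∀ {σ dl dr} → Small x → Small y → All (0 <_) (σ ++ dl) → All Large dr →
  MaxHookSubword σ (dl ++ x ∷ dr) → MaxHookSubword σ (dl ++ y ∷ dr)
MaxHookSubword-changeSmallʳ {x} {y} {σ} {dl} {dr} sx sy pσdl ldr (hρ , _ , bound) =
  Hook⇒IsHookWord (Hook-changeSmall sx sy dl (++⁻ʳ σ pσdl) ldr (IsHookWord⇒Hook hρ)) ,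
  Sublist.++⁺ˡ σ ⊆-refl ,
  subst₂ HookSubwordsAtMost (length-replace dl) (++-assoc σ dl (y ∷ dr))
    (HookSubwordsAtMost-changeSmall sx sy (σ ++ dl) pσdl ldr
      (subst (HookSubwordsAtMost _) (sym (++-assoc σ dl (x ∷ dr))) bound))

RowsCondition-changeSmall : ∀ {dl dr DR₂} → Small x → Small y → ∀ DR₁ →
  All (All Large) DR₁ → All (0 <_) dl → All Large dr → All (All (0 <_)) DR₂ →
  RowsCondition (DR₁ ++ (dl ++ x ∷ dr) ∷ DR₂) → RowsCondition (DR₁ ++ (dl ++ y ∷ dr) ∷ DR₂)
RowsCondition-changeSmall {DR₂ = []} _ _ [] _ _ _ _ _ = tt
RowsCondition-changeSmall {DR₂ = _ ∷ _} sx sy [] _ pdl ldr (pσ ∷ _) (max , rows) =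
  MaxHookSubword-changeSmallʳ sx sy (++⁺ pσ pdl) ldr max , rows
RowsCondition-changeSmall sx sy (_ ∷ []) (lρ ∷ []) pdl ldr pDR₂ (max , rows) =
  MaxHookSubword-changeSmallˡ sx sy pdl (++⁺ ldr lρ) max ,
  RowsCondition-changeSmall sx sy [] [] pdl ldr pDR₂ rows
RowsCondition-changeSmall sx sy (_ ∷ σ ∷ DR₁) (_ ∷ lDR₁) pdl ldr pDR₂ (max , rows) =
  max , RowsCondition-changeSmall sx sy (σ ∷ DR₁) lDR₁ pdl ldr pDR₂ rows

HasShape-replace : ∀ {μ} (R₁ : List (List A)) {row row′ R₂} → length row′ ≡ length row →
  HasShape μ (R₁ ++ row ∷ R₂) → HasShape μ (R₁ ++ row′ ∷ R₂)
HasShape-replace [] same (len ∷ shape) = trans same len ∷ shape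
HasShape-replace (_ ∷ R₁) same (len ∷ shape) = len ∷ HasShape-replace R₁ same shape

All-replace : ∀ {P : A → Set} xs {x y ys} → All P (xs ++ x ∷ ys) → P y → All P (xs ++ y ∷ ys)
All-replace [] (_ ∷ ps) py = py ∷ ps
All-replace (_ ∷ xs) (px ∷ ps) py = px ∷ All-replace xs ps py

IsDecTab-changeSmall : ∀ {μ dl dr DR₂} → Small x → Small y →
  ∀ DR₁ → All (All NotSmall) DR₁ → All NotSmall dr →
  IsDecTab μ (DR₁ ++ (dl ++ x ∷ dr) ∷ DR₂) → IsDecTab μ (DR₁ ++ (dl ++ y ∷ dr) ∷ DR₂)
IsDecTab-changeSmall {x} {y} {dl = dl} {dr} sx sy DR₁ nDR₁ ndr (shape , pos , hooks , rows) =
  HasShape-replace DR₁ (length-replace dl) shape ,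
  All-replace DR₁ pos (All-replace dl pRow (small-positive sy)) ,
  All-replace DR₁ hooks hook′ ,
  RowsCondition-changeSmall sx sy DR₁ lDR₁ pdl ldr (All.tail (++⁻ʳ DR₁ pos)) rows
  where
  pRow : All (0 <_) (dl ++ x ∷ dr)
  pRow = All.lookup pos (∈-insert DR₁)
  pdl : All (0 <_) dl
  pdl = ++⁻ˡ dl pRow
  ldr : All Large dr
  ldr = allLarge ndr (All.tail (++⁻ʳ dl pRow))
  lDR₁ : All (All Large) DR₁
  lDR₁ = All.zipWith (λ (n , p) → allLarge n p) (nDR₁ , ++⁻ˡ DR₁ pos)
  hook′ : IsHookWord (dl ++ y ∷ dr)
  hook′ = Hook⇒IsHookWord
    (Hook-changeSmall sx sy dl pdl ldr (IsHookWord⇒Hook (All.lookup hooks (∈-insert DR₁))))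

≡ᵇ-true⇒≡ : ∀ x y → (x ≡ᵇ y) ≡ true → x ≡ y
≡ᵇ-true⇒≡ x y e = ≡ᵇ⇒≡ x y (subst Bool.T (sym e) tt)

≡ᵇ-false⇒≢ : ∀ x y → (x ≡ᵇ y) ≡ false → x ≢ y
≡ᵇ-false⇒≢ x _ e refl = subst Bool.T e (≡⇒≡ᵇ x x refl)

multiplicity-≡ : ∀ z w → multiplicity z (z ∷ w) ≡ suc (multiplicity z w)
multiplicity-≡ z w with z ≡ᵇ z in e
... | true = refl
... | false = ⊥-elim (≡ᵇ-false⇒≢ z z e refl)

multiplicity-≢ : ∀ z w → u ≢ z → multiplicity z (u ∷ w) ≡ multiplicity z w
multiplicity-≢ {u} z w u≢z with z ≡ᵇ u in e
... | true = ⊥-elim (u≢z (sym (≡ᵇ-true⇒≡ z u e)))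
... | false = refl

multiplicity-∷-≤ : ∀ z u w → multiplicity z w ≤ multiplicity z (u ∷ w)
multiplicity-∷-≤ z u w with z ≡ᵇ u
... | true = n≤1+n _
... | false = ≤-refl

multiplicity≡0⇒All≢ : ∀ w → multiplicity z w ≡ 0 → All (_≢ z) w
multiplicity≡0⇒All≢ [] _ = []
multiplicity≡0⇒All≢ {z} (u ∷ w) m≡0 with z ≡ᵇ u in e
... | false = ≢-sym (≡ᵇ-false⇒≢ z u e) ∷ multiplicity≡0⇒All≢ w m≡0

All≢⇒multiplicity≡0 : All (_≢ z) w → multiplicity z w ≡ 0
All≢⇒multiplicity≡0 [] = refl
All≢⇒multiplicity≡0 {z} {_ ∷ w} (u≢z ∷ w≢z) = trans (multiplicity-≢ z w u≢z) (All≢⇒multiplicity≡0 w≢z)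

multiplicity-replace-≤ : ∀ z a → y ≢ z → multiplicity z (a ++ y ∷ b) ≤ multiplicity z (a ++ x ∷ b)
multiplicity-replace-≤ {b = b} {x} z [] y≢z =
  ≤-trans (≤-reflexive (multiplicity-≢ z b y≢z)) (multiplicity-∷-≤ z x b)
multiplicity-replace-≤ z (u ∷ a) y≢z with z ≡ᵇ u
... | true = s≤s (multiplicity-replace-≤ z a y≢z)
... | false = multiplicity-replace-≤ z a y≢z

multiplicity-after : ∀ z a b → suc (multiplicity z b) ≤ multiplicity z (a ++ z ∷ b)
multiplicity-after z [] b = ≤-reflexive (sym (multiplicity-≡ z b))
multiplicity-after z (u ∷ a) b = ≤-trans (multiplicity-after z a b) (multiplicity-∷-≤ z u (a ++ z ∷ b))

multiplicity-unique : ∀ z a → All (_≢ z) a → All (_≢ z) b → multiplicity z (a ++ z ∷ b) ≡ 1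
multiplicity-unique {b} z [] _ b≢z = trans (multiplicity-≡ z b) (cong suc (All≢⇒multiplicity≡0 b≢z))
multiplicity-unique {b} z (_ ∷ a) (u≢z ∷ a≢z) b≢z =
  trans (multiplicity-≢ z (a ++ z ∷ b) u≢z) (multiplicity-unique z a a≢z b≢z)

Linked-replace : ∀ a → Linked _≥_ (a ++ x ∷ b) → All (y ≤_) a → All (_≤ y) b → Linked _≥_ (a ++ y ∷ b)
Linked-replace {b = []} [] _ _ _ = [-]
Linked-replace {b = _ ∷ _} [] dec _ (v≤y ∷ _) = v≤y ∷ Linked.tail dec
Linked-replace (_ ∷ []) dec (y≤u ∷ _) b≤y = y≤u ∷ Linked-replace [] (Linked.tail dec) [] b≤y
Linked-replace (_ ∷ _ ∷ a) dec (_ ∷ a≥y) b≤y =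
  Linked.head dec ∷ Linked-replace (_ ∷ a) (Linked.tail dec) a≥y b≤y

decreasing⇒suffix≤ : ∀ a → Linked _≥_ (a ++ x ∷ b) → All (_≤ x) b
decreasing⇒suffix≤ {b = []} [] _ = []
decreasing⇒suffix≤ {b = _ ∷ _} [] (v≤x ∷ dec) =
  v≤x ∷ All.map (λ w≤v → ≤-trans w≤v v≤x) (decreasing⇒suffix≤ [] dec)
decreasing⇒suffix≤ (_ ∷ a) dec = decreasing⇒suffix≤ a (Linked.tail dec)

KeepsBoxesValid : ℕ → ℕ → Set
KeepsBoxesValid x y = ∀ a b → All NotSmall a →
  ValidBox (a ++ x ∷ b) → OnlyOneRepeats (a ++ x ∷ b) →
  ValidBox (a ++ y ∷ b) × OnlyOneRepeats (a ++ y ∷ b)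

++-∷-nonempty : ∀ (a : List A) {x b} → a ++ x ∷ b ≢ []
++-∷-nonempty [] ()
++-∷-nonempty (_ ∷ _) ()

large⇒≥small : Small y → All Large a → All (y ≤_) a
large⇒≥small sy = All.map (λ lu → ≤-trans (n≤1+n _) (small<large sy lu))

keepsBoxesValid-2→1 : KeepsBoxesValid 2 1
keepsBoxesValid-2→1 a b na (_ , dec , pos) once =
  (++-∷-nonempty a ,
   Linked-replace a dec (large⇒≥small one (allLarge na (++⁻ˡ a pos))) b≤1 ,
   All-replace a pos (s≤s z≤n)) ,
  λ z z≢1 → ≤-trans (multiplicity-replace-≤ z a (≢-sym z≢1)) (once z z≢1)
  where
  b≢2 : All (_≢ 2) b
  b≢2 = multiplicity≡0⇒All≢ b (n≤0⇒n≡0 (≤-pred (≤-trans (multiplicity-after 2 a b) (once 2 λ ()))))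
  b≤1 : All (_≤ 1) b
  b≤1 = All.zipWith (λ (v≤2 , v≢2) → ≤-pred (≤∧≢⇒< v≤2 v≢2)) (decreasing⇒suffix≤ a dec , b≢2)

keepsBoxesValid-1→2 : KeepsBoxesValid 1 2
keepsBoxesValid-1→2 a b na (_ , dec , pos) once =
  (++-∷-nonempty a ,
   Linked-replace a dec (large⇒≥small two (allLarge na (++⁻ˡ a pos))) b≤2 ,
   All-replace a pos (s≤s z≤n)) ,
  once′
  where
  b≤1 : All (_≤ 1) b
  b≤1 = decreasing⇒suffix≤ a dec
  b≤2 : All (_≤ 2) b
  b≤2 = All.map (λ v≤1 → ≤-trans v≤1 (n≤1+n _)) b≤1
  ≤1⇒≢2 : u ≤ 1 → u ≢ 2
  ≤1⇒≢2 (s≤s ()) refl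
  once′ : OnlyOneRepeats (a ++ 2 ∷ b)
  once′ z z≢1 with z ≟ 2
  ... | no z≢2 = ≤-trans (multiplicity-replace-≤ z a (≢-sym z≢2)) (once z z≢1)
  ... | yes refl = ≤-reflexive (multiplicity-unique 2 a (All.map (notSmall⇒≢ two) na) (All.map ≤1⇒≢2 b≤1))

-- Change P x y T U: in the box of row ∣R₁∣+1 and column ∣L∣+1 of T, the entry x (stored after
-- the larger entries b₁) becomes y; the letters read before it in revrow, namely R₁, the boxes Rb
-- to its right and b₁, all satisfy P.
data Change (P : ℕ → Set) (x y : ℕ) : MTab → MTab → Set where
  change : ∀ R₁ L b₁ b₂ Rb R₂ → All (All (All P)) R₁ → All (All P) Rb → All P b₁ →
           Change P x y (R₁ ++ (L ++ (b₁ ++ x ∷ b₂) ∷ Rb) ∷ R₂)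
                        (R₁ ++ (L ++ (b₁ ++ y ∷ b₂) ∷ Rb) ∷ R₂)

Change-flip : ∀ {P T U} → Change P x y T U → Change P y x U T
Change-flip (change R₁ L b₁ b₂ Rb R₂ pR₁ pRb pb₁) = change R₁ L b₁ b₂ Rb R₂ pR₁ pRb pb₁

Change-map : ∀ {P Q : ℕ → Set} {T U} → (∀ {z} → P z → Q z) → Change P x y T U → Change Q x y T U
Change-map f (change R₁ L b₁ b₂ Rb R₂ pR₁ pRb pb₁) =
  change R₁ L b₁ b₂ Rb R₂ (All.map (All.map (All.map f)) pR₁) (All.map (All.map f) pRb) (All.map f pb₁)

Pointwise-split : ∀ {B : Set} {R : A → B → Set} (xs₁ : List B) {x xs₂ ys} →
  Pointwise R ys (xs₁ ++ x ∷ xs₂) →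
  ∃[ ys₁ ] ∃[ y ] ∃[ ys₂ ] (ys ≡ ys₁ ++ y ∷ ys₂ × Pointwise R ys₁ xs₁ × R y x × Pointwise R ys₂ xs₂)
Pointwise-split [] (r ∷ rs) = [] , _ , _ , refl , [] , r , rs
Pointwise-split (_ ∷ xs₁) (r ∷ rs) with Pointwise-split xs₁ rs
... | ys₁ , y , ys₂ , refl , rs₁ , ry , rs₂ = _ ∷ ys₁ , y , ys₂ , refl , r ∷ rs₁ , ry , rs₂

Pointwise-insert : ∀ {B : Set} {R : A → B → Set} {ys₁ y ys₂ xs₁ x xs₂} →
  Pointwise R ys₁ xs₁ → R y x → Pointwise R ys₂ xs₂ → Pointwise R (ys₁ ++ y ∷ ys₂) (xs₁ ++ x ∷ xs₂)
Pointwise-insert rs₁ r rs₂ = Pointwise.++⁺ rs₁ (r ∷ rs₂)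

chosen-All : ∀ {P : ℕ → Set} {ds bs} → Pointwise _∈_ ds bs → All (All P) bs → All P ds
chosen-All [] [] = []
chosen-All (d∈ ∷ ds∈) (pb ∷ pbs) = All.lookup pb d∈ ∷ chosen-All ds∈ pbs

distribution-All : ∀ {P : ℕ → Set} {D T} → IsDistribution D T → All (All (All P)) T → All (All P) D
distribution-All [] [] = []
distribution-All (ds∈ ∷ D∈) (pRow ∷ pRows) = chosen-All ds∈ pRow ∷ distribution-All D∈ pRows

∈-replace : ∀ a {b} → u ∈ a ++ y ∷ b → u ≡ y ⊎ u ∈ a ++ x ∷ b
∈-replace a u∈ with ∈-++⁻ a u∈
... | inj₁ u∈a = inj₂ (∈-++⁺ˡ u∈a)
... | inj₂ (here refl) = inj₁ refl
... | inj₂ (there u∈b) = inj₂ (∈-++⁺ʳ a (there u∈b))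

-- A distribution of U either chooses a letter other than the new y, and is then a distribution of T,
-- or chooses y, and then arises from a distribution of T by the change of a small letter.
SetDecTab*-change : ∀ {μ T U} → Small x → Small y → KeepsBoxesValid x y → Change NotSmall x y T U →
  SetDecTab* μ T → SetDecTab* μ U
SetDecTab*-change {x} {y} {μ} sx sy keeps (change R₁ L b₁ b₂ Rb R₂ nR₁ nRb nb₁)
                  (shape , valid , once , decTab) =
  HasShape-replace R₁ (length-replace L) shape ,
  All-replace R₁ valid (All-replace L validRow (proj₁ box′)) ,
  All-replace R₁ once (All-replace L onceRow (proj₂ box′)) ,
  decTab′
  where
  validRow : All ValidBox (L ++ (b₁ ++ x ∷ b₂) ∷ Rb)
  validRow = All.lookup valid (∈-insert R₁)
  onceRow : All OnlyOneRepeats (L ++ (b₁ ++ x ∷ b₂) ∷ Rb)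
  onceRow = All.lookup once (∈-insert R₁)
  box′ : ValidBox (b₁ ++ y ∷ b₂) × OnlyOneRepeats (b₁ ++ y ∷ b₂)
  box′ = keeps b₁ b₂ nb₁ (All.lookup validRow (∈-insert L)) (All.lookup onceRow (∈-insert L))
  decTab′ : (D : List (List ℕ)) → IsDistribution D (R₁ ++ (L ++ (b₁ ++ y ∷ b₂) ∷ Rb) ∷ R₂) →
    IsDecTab μ D
  decTab′ D D∈ with Pointwise-split R₁ D∈
  ... | DR₁ , drow , DR₂ , refl , DR₁∈ , drow∈ , DR₂∈ with Pointwise-split L drow∈
  ... | dl , d , dr , refl , dl∈ , d∈ , dr∈ with ∈-replace {x = x} b₁ d∈
  ... | inj₂ d∈old = decTab _ (Pointwise-insert DR₁∈ (Pointwise-insert dl∈ d∈old dr∈) DR₂∈)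
  ... | inj₁ refl =
    IsDecTab-changeSmall sx sy DR₁ (distribution-All DR₁∈ nR₁) (chosen-All dr∈ nRb)
      (decTab _ (Pointwise-insert DR₁∈ (Pointwise-insert dl∈ (∈-insert b₁) dr∈) DR₂∈))

Fails : ∀ {B : Set} → (A → Maybe B) → A → Set
Fails g a = g a ≡ nothing

data FirstReplaced (g : A → Maybe A) : List A → List A → Set where
  replaced : ∀ xs {z z′} ys → All (Fails g) xs → g z ≡ just z′ →
             FirstReplaced g (xs ++ z ∷ ys) (xs ++ z′ ∷ ys)

data LastReplaced (g : A → Maybe A) : List A → List A → Set where
  replaced : ∀ xs {z z′} ys → All (Fails g) ys → g z ≡ just z′ →
             LastReplaced g (xs ++ z ∷ ys) (xs ++ z′ ∷ ys)

replFirst-just⁻ : ∀ (g : A → Maybe A) xs {ys} → replFirst g xs ≡ just ys → FirstReplaced g xs ys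
replFirst-just⁻ g (x ∷ xs) e with g x in gx
replFirst-just⁻ g (x ∷ xs) refl | just _ = replaced [] xs [] gx
... | nothing with replFirst g xs in e′
replFirst-just⁻ g (x ∷ xs) refl | nothing | just _ with replFirst-just⁻ g xs e′
... | replaced xs₁ xs₂ fails gz = replaced (x ∷ xs₁) xs₂ (gx ∷ fails) gz

replFirst-just⁺ : ∀ {g : A → Maybe A} {xs z z′ ys} → All (Fails g) xs → g z ≡ just z′ →
  replFirst g (xs ++ z ∷ ys) ≡ just (xs ++ z′ ∷ ys)
replFirst-just⁺ [] gz rewrite gz = refl
replFirst-just⁺ {g = g} {_ ∷ xs} {z} {_} {ys} (gx ∷ fails) gz rewrite gx
  with replFirst g (xs ++ z ∷ ys) | replFirst-just⁺ {ys = ys} fails gz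
... | _ | refl = refl

replFirst-nothing⁻ : ∀ (g : A → Maybe A) xs → Fails (replFirst g) xs → All (Fails g) xs
replFirst-nothing⁻ g [] _ = []
replFirst-nothing⁻ g (x ∷ xs) e with g x in gx
... | nothing with replFirst g xs in e′
... | nothing = gx ∷ replFirst-nothing⁻ g xs e′

replFirst-nothing⁺ : ∀ {g : A → Maybe A} {xs} → All (Fails g) xs → Fails (replFirst g) xs
replFirst-nothing⁺ [] = refl
replFirst-nothing⁺ {g = g} {_ ∷ xs} (gx ∷ fails) rewrite gx with replFirst g xs | replFirst-nothing⁺ fails
... | _ | refl = refl

All-reverse⁺ : ∀ {P : A → Set} {xs} → All P xs → All P (reverse xs)
All-reverse⁺ {xs = xs} = All-resp-↭ (↭-sym (↭-reverse xs))

All-reverse⁻ : ∀ {P : A → Set} {xs} → All P (reverse xs) → All P xs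
All-reverse⁻ {xs = xs} = All-resp-↭ (↭-reverse xs)

reverse-insert : ∀ (xs : List A) {z} ys → reverse (xs ++ z ∷ ys) ≡ reverse ys ++ z ∷ reverse xs
reverse-insert xs {z} ys = begin
  reverse (xs ++ z ∷ ys)           ≡⟨ reverse-++ xs (z ∷ ys) ⟩
  reverse (z ∷ ys) ++ reverse xs   ≡⟨ cong (_++ reverse xs) (unfold-reverse z ys) ⟩
  (reverse ys ++ z ∷ []) ++ reverse xs ≡⟨ ++-assoc (reverse ys) (z ∷ []) (reverse xs) ⟩
  reverse ys ++ z ∷ reverse xs     ∎
  where open ≡-Reasoning

-- replTab a b is replFirst (replLast (replFirst (replLetter a b))) by definition.
replLast : (A → Maybe A) → List A → Maybe (List A)
replLast g xs = mapMaybe' reverse (replFirst g (reverse xs))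

FirstReplaced-reverse : ∀ {g : A → Maybe A} {xs ys} →
  FirstReplaced g xs ys → LastReplaced g (reverse xs) (reverse ys)
FirstReplaced-reverse (replaced xs ys fails gz) =
  subst₂ (LastReplaced _) (sym (reverse-insert xs ys)) (sym (reverse-insert xs ys))
    (replaced (reverse ys) (reverse xs) (All-reverse⁺ fails) gz)

replLast-just⁻ : ∀ (g : A → Maybe A) xs {ys} → replLast g xs ≡ just ys → LastReplaced g xs ys
replLast-just⁻ g xs e with replFirst g (reverse xs) in e′
replLast-just⁻ g xs refl | just ys =
  subst (λ xs′ → LastReplaced g xs′ (reverse ys)) (reverse-involutive xs)
    (FirstReplaced-reverse (replFirst-just⁻ g (reverse xs) e′))

replLast-just⁺ : ∀ {g : A → Maybe A} {xs z z′ ys} → All (Fails g) ys → g z ≡ just z′ →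
  replLast g (xs ++ z ∷ ys) ≡ just (xs ++ z′ ∷ ys)
replLast-just⁺ {g = g} {xs} {z} {z′} {ys} fails gz = begin
  mapMaybe' reverse (replFirst g (reverse (xs ++ z ∷ ys)))
    ≡⟨ cong (mapMaybe' reverse ∘ replFirst g) (reverse-insert xs ys) ⟩
  mapMaybe' reverse (replFirst g (reverse ys ++ z ∷ reverse xs))
    ≡⟨ cong (mapMaybe' reverse) (replFirst-just⁺ (All-reverse⁺ fails) gz) ⟩
  just (reverse (reverse ys ++ z′ ∷ reverse xs))
    ≡⟨ cong just (reverse-insert (reverse ys) (reverse xs)) ⟩
  just (reverse (reverse xs) ++ z′ ∷ reverse (reverse ys))
    ≡⟨ cong₂ (λ p q → just (p ++ z′ ∷ q)) (reverse-involutive xs) (reverse-involutive ys) ⟩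
  just (xs ++ z′ ∷ ys) ∎
  where open ≡-Reasoning

replLast-nothing⁻ : ∀ (g : A → Maybe A) xs → Fails (replLast g) xs → All (Fails g) xs
replLast-nothing⁻ g xs e with replFirst g (reverse xs) in e′
... | nothing = All-reverse⁻ (replFirst-nothing⁻ g (reverse xs) e′)

replLast-nothing⁺ : ∀ {g : A → Maybe A} {xs} → All (Fails g) xs → Fails (replLast g) xs
replLast-nothing⁺ fails rewrite replFirst-nothing⁺ (All-reverse⁺ fails) = refl

replLetter-just⁻ : ∀ a b → replLetter a b z ≡ just u → z ≡ a × u ≡ b
replLetter-just⁻ {z} a b e with z ≡ᵇ a in za
replLetter-just⁻ {z} a b refl | true = ≡ᵇ-true⇒≡ z a za , refl

replLetter-self : ∀ a b → replLetter a b a ≡ just b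
replLetter-self a b with a ≡ᵇ a in aa
... | true = refl
... | false = ⊥-elim (≡ᵇ-false⇒≢ a a aa refl)

replLetter-nothing⁻ : ∀ a b → Fails (replLetter a b) z → z ≢ a
replLetter-nothing⁻ {z} a b e with z ≡ᵇ a in za
... | false = ≡ᵇ-false⇒≢ z a za

replLetter-nothing⁺ : ∀ a b → z ≢ a → Fails (replLetter a b) z
replLetter-nothing⁺ {z} a b z≢a with z ≡ᵇ a in za
... | true = ⊥-elim (z≢a (≡ᵇ-true⇒≡ z a za))
... | false = refl

replTab-just⁻ : ∀ x y T {U} → replTab x y T ≡ just U → Change (_≢ x) x y T U
replTab-just⁻ x y T e with replFirst-just⁻ (replLast (replFirst (replLetter x y))) T e
... | replaced R₁ {row} R₂ rowFails eRow with replLast-just⁻ (replFirst (replLetter x y)) row eRow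
... | replaced L {box} Rb boxFails eBox with replFirst-just⁻ (replLetter x y) box eBox
... | replaced b₁ {letter} b₂ letterFails eLetter with replLetter-just⁻ {letter} x y eLetter
... | refl , refl =
  change R₁ L b₁ b₂ Rb R₂ (All.map rowAvoids rowFails) (All.map boxAvoids boxFails)
    (All.map letterAvoids letterFails)
  where
  letterAvoids : Fails (replLetter x y) z → z ≢ x
  letterAvoids = replLetter-nothing⁻ x y
  boxAvoids : ∀ {box} → Fails (replFirst (replLetter x y)) box → All (_≢ x) box
  boxAvoids = All.map letterAvoids ∘ replFirst-nothing⁻ _ _
  rowAvoids : ∀ {row} → Fails (replLast (replFirst (replLetter x y))) row → All (All (_≢ x)) row
  rowAvoids = All.map boxAvoids ∘ replLast-nothing⁻ _ _

replTab-just⁺ : ∀ {T U} → Change (_≢ x) x y T U → replTab x y T ≡ just U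
replTab-just⁺ {x} {y} (change R₁ L b₁ b₂ Rb R₂ avoidR₁ avoidRb avoidb₁) =
  replFirst-just⁺ (All.map rowFails avoidR₁)
    (replLast-just⁺ (All.map boxFails avoidRb)
      (replFirst-just⁺ (All.map letterFails avoidb₁) (replLetter-self x y)))
  where
  letterFails : z ≢ x → Fails (replLetter x y) z
  letterFails = replLetter-nothing⁺ x y
  boxFails : ∀ {box} → All (_≢ x) box → Fails (replFirst (replLetter x y)) box
  boxFails = replFirst-nothing⁺ ∘ All.map letterFails
  rowFails : ∀ {row} → All (All (_≢ x)) row → Fails (replLast (replFirst (replLetter x y))) row
  rowFails = replLast-nothing⁺ ∘ All.map boxFails

readBefore : List (List Box) → List Box → Box → List ℕ
readBefore R₁ Rb b₁ = revrow R₁ ++ concat (reverse Rb) ++ b₁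

++-reassoc : (A₁ A₂ A₃ A₄ A₅ A₆ : List ℕ) →
  A₁ ++ (A₂ ++ (A₃ ++ A₄) ++ A₅) ++ A₆ ≡ (A₁ ++ A₂ ++ A₃) ++ A₄ ++ A₅ ++ A₆
++-reassoc A₁ A₂ A₃ A₄ A₅ A₆ = solve (++-monoid ℕ)

revrow-change : ∀ R₁ L b₁ x b₂ Rb R₂ →
  revrow (R₁ ++ (L ++ (b₁ ++ x ∷ b₂) ∷ Rb) ∷ R₂) ≡
  readBefore R₁ Rb b₁ ++ x ∷ b₂ ++ concat (reverse L) ++ revrow R₂
revrow-change R₁ L b₁ x b₂ Rb R₂ = begin
  revrow (R₁ ++ (L ++ box ∷ Rb) ∷ R₂)
    ≡⟨ concatMap-++ (concat ∘ reverse) R₁ _ ⟩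
  revrow R₁ ++ concat (reverse (L ++ box ∷ Rb)) ++ revrow R₂
    ≡⟨ cong (λ row → revrow R₁ ++ concat row ++ revrow R₂) (reverse-insert L Rb) ⟩
  revrow R₁ ++ concat (reverse Rb ++ box ∷ reverse L) ++ revrow R₂
    ≡⟨ cong (λ row → revrow R₁ ++ row ++ revrow R₂) (sym (concat-++ (reverse Rb) (box ∷ reverse L))) ⟩
  revrow R₁ ++ (concat (reverse Rb) ++ (b₁ ++ x ∷ b₂) ++ concat (reverse L)) ++ revrow R₂
    ≡⟨ ++-reassoc (revrow R₁) (concat (reverse Rb)) b₁ (x ∷ b₂) (concat (reverse L)) (revrow R₂) ⟩
  readBefore R₁ Rb b₁ ++ x ∷ b₂ ++ concat (reverse L) ++ revrow R₂ ∎
  where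
  open ≡-Reasoning
  box : Box
  box = b₁ ++ x ∷ b₂

All-revrow⁺ : ∀ {P : ℕ → Set} {R} → All (All (All P)) R → All P (revrow R)
All-revrow⁺ [] = []
All-revrow⁺ (p ∷ ps) = ++⁺ (concat⁺ (All-reverse⁺ p)) (All-revrow⁺ ps)

All-revrow⁻ : ∀ {P : ℕ → Set} R → All P (revrow R) → All (All (All P)) R
All-revrow⁻ [] _ = []
All-revrow⁻ (row ∷ R) ps =
  All-reverse⁻ (concat⁻ (++⁻ˡ (concat (reverse row)) ps)) ∷ All-revrow⁻ R (++⁻ʳ (concat (reverse row)) ps)

All-readBefore⁺ : ∀ {P : ℕ → Set} {R₁ Rb b₁} →
  All (All (All P)) R₁ → All (All P) Rb → All P b₁ → All P (readBefore R₁ Rb b₁)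
All-readBefore⁺ pR₁ pRb pb₁ = ++⁺ (All-revrow⁺ pR₁) (++⁺ (concat⁺ (All-reverse⁺ pRb)) pb₁)

All-readBefore⁻ : ∀ {P : ℕ → Set} R₁ Rb {b₁} →
  All P (readBefore R₁ Rb b₁) → All (All (All P)) R₁ × All (All P) Rb × All P b₁
All-readBefore⁻ {P} R₁ Rb {b₁} ps =
  All-revrow⁻ R₁ (++⁻ˡ (revrow R₁) ps) ,
  All-reverse⁻ (concat⁻ (++⁻ˡ (concat (reverse Rb)) rest)) ,
  ++⁻ʳ (concat (reverse Rb)) rest
  where
  rest : All P (concat (reverse Rb) ++ b₁)
  rest = ++⁻ʳ (revrow R₁) ps

firstOf12-small : Small x → firstOf12 (x ∷ w) ≡ just x
firstOf12-small one = refl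
firstOf12-small two = refl

firstOf12-notSmall : NotSmall u → firstOf12 (u ∷ w) ≡ firstOf12 w
firstOf12-notSmall {0} _ = refl
firstOf12-notSmall {1} nu = ⊥-elim (nu one)
firstOf12-notSmall {2} nu = ⊥-elim (nu two)
firstOf12-notSmall {suc (suc (suc _))} _ = refl

firstOf12-after-notSmall : Small x → All NotSmall w → firstOf12 (w ++ x ∷ b) ≡ just x
firstOf12-after-notSmall sx [] = firstOf12-small sx
firstOf12-after-notSmall sx (nu ∷ nw) = trans (firstOf12-notSmall nu) (firstOf12-after-notSmall sx nw)

firstOf12≡⇒notSmall : ∀ w → All (_≢ x) w → firstOf12 (w ++ x ∷ b) ≡ just x → All NotSmall w
firstOf12≡⇒notSmall [] _ _ = []
firstOf12≡⇒notSmall (u ∷ w) (u≢x ∷ w≢x) first with small? u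
... | yes su = ⊥-elim (u≢x (just-injective (trans (sym (firstOf12-small su)) first)))
... | no nu = nu ∷ firstOf12≡⇒notSmall w w≢x (trans (sym (firstOf12-notSmall nu)) first)

firstSmall-replTab⇔Change : ∀ T U → Small x →
  (firstOf12 (revrow T) ≡ just x × replTab x y T ≡ just U) ⇔ Change NotSmall x y T U
firstSmall-replTab⇔Change {x} {y} T U sx = mk⇔ to from
  where
  to : firstOf12 (revrow T) ≡ just x × replTab x y T ≡ just U → Change NotSmall x y T U
  to (first , e) with replTab-just⁻ x y T e
  ... | change R₁ L b₁ b₂ Rb R₂ aR₁ aRb ab₁ =
    let (nR₁ , nRb , nb₁) = All-readBefore⁻ R₁ Rb
          (firstOf12≡⇒notSmall _ (All-readBefore⁺ aR₁ aRb ab₁)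
            (trans (cong firstOf12 (sym (revrow-change R₁ L b₁ x b₂ Rb R₂))) first))
    in change R₁ L b₁ b₂ Rb R₂ nR₁ nRb nb₁
  from : Change NotSmall x y T U → firstOf12 (revrow T) ≡ just x × replTab x y T ≡ just U
  from c@(change R₁ L b₁ b₂ Rb R₂ nR₁ nRb nb₁) =
    trans (cong firstOf12 (revrow-change R₁ L b₁ x b₂ Rb R₂))
      (firstOf12-after-notSmall sx (All-readBefore⁺ nR₁ nRb nb₁)) ,
    replTab-just⁺ (Change-map (notSmall⇒≢ sx) c)

e*₁≡just⇔ : ∀ T U → e*₁ T ≡ just U ⇔ (firstOf12 (revrow T) ≡ just 2 × replTab 2 1 T ≡ just U)
e*₁≡just⇔ T U with firstOf12 (revrow T)
... | nothing = mk⇔ (λ ()) (λ { (() , _) })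
... | just 0 = mk⇔ (λ ()) (λ { (() , _) })
... | just 1 = mk⇔ (λ ()) (λ { (() , _) })
... | just 2 = mk⇔ (refl ,_) proj₂
... | just (suc (suc (suc _))) = mk⇔ (λ ()) (λ { (() , _) })

f*₁≡just⇔ : ∀ T U → f*₁ T ≡ just U ⇔ (firstOf12 (revrow T) ≡ just 1 × replTab 1 2 T ≡ just U)
f*₁≡just⇔ T U with firstOf12 (revrow T)
... | nothing = mk⇔ (λ ()) (λ { (() , _) })
... | just 0 = mk⇔ (λ ()) (λ { (() , _) })
... | just 1 = mk⇔ (refl ,_) proj₂
... | just (suc (suc _)) = mk⇔ (λ ()) (λ { (() , _) })

e*₁≡just⇔Change : ∀ T U → e*₁ T ≡ just U ⇔ Change NotSmall 2 1 T U
e*₁≡just⇔Change T U = firstSmall-replTab⇔Change T U two ⇔-∘ e*₁≡just⇔ T U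

f*₁≡just⇔Change : ∀ T U → f*₁ T ≡ just U ⇔ Change NotSmall 1 2 T U
f*₁≡just⇔Change T U = firstSmall-replTab⇔Change T U one ⇔-∘ f*₁≡just⇔ T U

Change-flip⇔ : ∀ {P T U} → Change P x y T U ⇔ Change P y x U T
Change-flip⇔ = mk⇔ Change-flip Change-flip

proposition3p5 : (μ : List ℕ) → StrictPartition μ →
    ((T U : MTab) → SetDecTab* μ T → e*₁ T ≡ just U → SetDecTab* μ U)
    × ((T U : MTab) → SetDecTab* μ T → f*₁ T ≡ just U → SetDecTab* μ U)
    × ((T U : MTab) → SetDecTab* μ T → SetDecTab* μ U →
         (e*₁ T ≡ just U) ⇔ (f*₁ U ≡ just T))
-- The equivalence holds for arbitrary tableaux, and μ need not be strict.
proposition3p5 μ _ =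
  (λ T U tab e → SetDecTab*-change two one keepsBoxesValid-2→1 (Equivalence.to (e*₁≡just⇔Change T U) e) tab) ,
  (λ T U tab f → SetDecTab*-change one two keepsBoxesValid-1→2 (Equivalence.to (f*₁≡just⇔Change T U) f) tab) ,
  (λ T U _ _ → ⇔-sym (f*₁≡just⇔Change U T) ⇔-∘ (Change-flip⇔ ⇔-∘ e*₁≡just⇔Change T U))
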